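{- Let $\varepsilon\colon X^{\times}_{\mathrm{irr}}\to\mathcal{P}(M)$ be a Fitch map and let $\widehat{T}(\varepsilon)=(\widehat{T},\widehat{\lambda})$ be the $\varepsilon$-tree. Then $\widehat{T}(\varepsilon)$ is the unique (up to isomorphism) least-resolved tree that explains $\varepsilon$. In particular, $\widehat{T}$ has the minimum number of vertices, and $\sum_{e\in E(\widehat{T})}|\widehat{\lambda}(e)|$ is minimum, among all edge-labeled trees that explain $\varepsilon$.
   Context: $X$ is a finite nonempty set, $M$ a finite nonempty set of colors, $X^{\times}_{\mathrm{irr}}=\{(x,y)\in X\times X: x\neq y\}$. A phylogenetic tree on $X$ is a rooted tree whose leaves (non-root vertices of degree $1$) form $X$, whose root has degree $\ge2$ and whose non-root inner vertices have degree $\ge3$; it is determined up to isomorphism by its cluster set $\mathcal{C}(T)=\{C_T(v):v\in V(T)\}$ ($C_T(v)$ = leaves descending from $v$). $\mathrm{lca}(x,y)$ is the last common ancestor; edges are written $(\mathrm{par}(v),v)$. An edge-labeled tree $(T,\lambda)$ on $X$ with $M$ is a phylogenetic tree $T$ on $X$ with $\lambda\colon E(T)\to\mathcal{P}(M)$; $e$ is an $m$-edge if $m\in\lambda(e)$. $(T,\lambda)$ explains $\varepsilon$ if for all $(x,y)\in X^{\times}_{\mathrm{irr}}$, $m\in M$: $m\in\varepsilon(x,y)$ iff the path from $\mathrm{lca}(x,y)$ to $y$ contains an $m$-edge; $\varepsilon$ is a Fitch map if some edge-labeled tree explains it. $N_m[y]=\{x\in X\setminus\{y\}: m\notin\varepsilon(x,y)\}\cup\{y\}$,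 $\mathcal{N}[\varepsilon]=\{N_m[y]: y\in X, m\in M\}$. The $\varepsilon$-tree: $\widehat{T}$ is the phylogenetic tree with $\mathcal{C}(\widehat{T})=\mathcal{N}[\varepsilon]\cup\{X\}\cup\{\{x\}:x\in X\}$ and $\widehat{\lambda}(\mathrm{par}(v),v)=\{m\in M:\exists y\in X,\ C_{\widehat{T}}(v)=N_m[y]\}$. $(T',\lambda')$ is a coarse-graining of $(T,\lambda)$ if $\mathcal{C}(T')\subseteq\mathcal{C}(T)$ and for all non-root $v'\in V(T')$, non-root $v\in V(T)$ with $C_T(v)=C_{T'}(v')$: $\lambda'(\mathrm{par}_{T'}(v'),v')\subseteq\lambda(\mathrm{par}_T(v),v)$; it is strict if moreover $\mathcal{C}(T')\subsetneq\mathcal{C}(T)$ or one of these label inclusions is strict. Two edge-labeled trees are isomorphic if each is a coarse-graining of the other. An edge-labeled tree explaining $\varepsilon$ is least-resolved w.r.t. $\varepsilon$ if no strict coarse-graining of it explains $\varepsilon$. -}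

module Defs where

open import Data.Nat using (ℕ; zero; suc; _+_; _≤_)
open import Data.Bool using (Bool; true; false; _∨_)
import Data.Bool as B
open import Data.Fin using (Fin)
open import Data.Fin.Subset using (Subset; _∈_; _∉_; _⊆_; _∩_; ⊤; ⊥; ⁅_⁆; ∣_∣; inside; outside)
open import Data.Fin.Properties using (any?)
open import Data.Fin.Subset.Properties using (_∈?_)
open import Data.Vec using (Vec; []; _∷_; tabulate)
open import Data.Vec.Properties using (≡-dec)
open import Data.List using (List; []; _∷_; _++_; map; filter; length)
open import Data.Nat.ListAction using (sum)
open import Data.Product using (Σ; ∃; ∃-syntax; _×_; _,_)
open import Data.Sum using (_⊎_)
open import Relation.Nullary using (¬_; Dec; does)
open import Relation.Binary.PropositionalEquality using (_≡_; _≢_)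

-- X = Fin n (leaves), M = Fin k (colours).
-- A phylogenetic tree on X is represented by its cluster set C(T)
-- (it is determined up to isomorphism by it), given as a Boolean
-- indicator on subsets of X.  An edge (par(v),v) of T corresponds to the
-- non-root vertex v, i.e. to a cluster A = C_T(v) with A ≠ X; the edge
-- label λ(par(v),v) is stored as  lab A .  (Values of  lab  on subsets
-- that are not non-root clusters are irrelevant and never used.)

record LTree (n k : ℕ) : Set where
  field
    cl  : Subset n → Bool
    lab : Subset n → Subset k

open LTree public

IsCl : ∀ {n k} → LTree n k → Subset n → Set
IsCl T A = cl T A ≡ true

IsEdge : ∀ {n k} → LTree n k → Subset n → Set
IsEdge T A = IsCl T A × A ≢ ⊤

-- The cluster system of a phylogenetic tree on X: a hierarchy containing
-- X and all singletons, not containing ∅ (these are exactly the cluster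
-- sets of phylogenetic trees on X).
IsPhylo : ∀ {n k} → LTree n k → Set
IsPhylo {n} T =
  IsCl T ⊤ ×
  (∀ (x : Fin n) → IsCl T ⁅ x ⁆) ×
  (cl T ⊥ ≡ false) ×
  (∀ A B → IsCl T A → IsCl T B → A ⊆ B ⊎ B ⊆ A ⊎ A ∩ B ≡ ⊥)

-- Maps ε : X^×_irr → P(M); values on the diagonal are ignored.
EpsMap : ℕ → ℕ → Set
EpsMap n k = Fin n → Fin n → Subset k

-- (T,λ) explains ε.  For x ≠ y the edges (par(v),v) on the path from
-- lca(x,y) to y are exactly those with y ∈ C(v) and x ∉ C(v).
Explains : ∀ {n k} → EpsMap n k → LTree n k → Set
Explains {n} {k} ε T =
  ∀ (x y : Fin n) → x ≢ y → ∀ (m : Fin k) →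
    (m ∈ ε x y → ∃[ A ] (IsEdge T A × y ∈ A × x ∉ A × m ∈ lab T A)) ×
    (∃[ A ] (IsEdge T A × y ∈ A × x ∉ A × m ∈ lab T A) → m ∈ ε x y)

IsFitch : ∀ {n k} → EpsMap n k → Set
IsFitch ε = ∃[ T ] (IsPhylo T × Explains ε T)

decFin : ∀ {n} (a b : Fin n) → Dec (a ≡ b)
decFin = Data.Fin._≟_

decSub : ∀ {n} (A B : Subset n) → Dec (A ≡ B)
decSub = ≡-dec B._≟_

Nbh : ∀ {n k} → EpsMap n k → Fin k → Fin n → Subset n
Nbh {n} ε m y = tabulate f
  where
  f : Fin n → Bool
  f x with does (decFin x y)
  ... | true  = inside
  ... | false = B.not (does (m ∈? ε x y))

epsTree : ∀ {n k} → EpsMap n k → LTree n k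
epsTree {n} {k} ε = record { cl = c ; lab = l }
  where
  c : Subset n → Bool
  c A = does (decSub A ⊤)
      ∨ does (any? (λ x → decSub A ⁅ x ⁆))
      ∨ does (any? (λ y → any? (λ m → decSub A (Nbh ε m y))))
  l : Subset n → Subset k
  l A = tabulate (λ m → does (any? (λ y → decSub A (Nbh ε m y))))

CoarseGraining : ∀ {n k} → LTree n k → LTree n k → Set
CoarseGraining T' T =
  (∀ A → IsCl T' A → IsCl T A) ×
  (∀ A → IsEdge T' A → lab T' A ⊆ lab T A)

StrictCoarseGraining : ∀ {n k} → LTree n k → LTree n k → Set
StrictCoarseGraining T' T =
  CoarseGraining T' T ×
  ((∃[ A ] (IsCl T A × ¬ IsCl T' A)) ⊎
   (∃[ A ] (IsEdge T' A × ∃[ m ] (m ∈ lab T A × m ∉ lab T' A))))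

Isomorphic : ∀ {n k} → LTree n k → LTree n k → Set
Isomorphic T T' = CoarseGraining T T' × CoarseGraining T' T

LeastResolved : ∀ {n k} → EpsMap n k → LTree n k → Set
LeastResolved ε T =
  Explains ε T ×
  (∀ T' → IsPhylo T' → StrictCoarseGraining T' T → ¬ Explains ε T')

allSubsets : (n : ℕ) → List (Subset n)
allSubsets zero    = [] ∷ []
allSubsets (suc n) = map (inside ∷_) (allSubsets n) ++ map (outside ∷_) (allSubsets n)

clusters : ∀ {n k} → LTree n k → List (Subset n)
clusters {n} T = filter (λ A → cl T A B.≟ true) (allSubsets n)

numVertices : ∀ {n k} → LTree n k → ℕ
numVertices T = length (clusters T)

labelWeight : ∀ {n k} → LTree n k → ℕ
labelWeight {n} T =
  sum (map (λ A → ∣ lab T A ∣)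
           (filter (λ A → B.T? (cl T A B.∧ B.not (does (decSub A ⊤)))) (allSubsets n)))

-- Fix a tree T explaining ε.  For x ≠ y, m ∈ ε(x,y) iff some m-edge above y lies below
-- lca(x,y), i.e. iff x lies outside the cluster of the lowest m-edge above y (the m-edges
-- above y form a chain).  So N_m[y] is that cluster, or X if there is no m-edge above y,
-- and every cluster and every label of the ε-tree already occurs in T: the ε-tree is a
-- coarse-graining of every tree explaining ε, in particular of the one witnessing that ε is
-- a Fitch map.  It follows that the ε-tree is phylogenetic and explains ε, that a strict
-- coarse-graining of it explaining ε would have to contain it again, that a least-resolved
-- tree cannot strictly refine it, and that vertex count and label weight can only drop under
-- coarse-graining.

module Submission where

open import Defs
open import Data.Nat using (ℕ; zero; suc; _≤_; z≤n; s≤s)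
open import Data.Nat.Properties using (+-mono-≤; ≤-trans; m≤n+m; m≤n⇒m≤1+n)
open import Data.Nat.ListAction using (sum)
open import Data.Bool using (Bool; true; false; not; _∧_)
import Data.Bool as Bool
open import Data.Bool.Properties using (¬-not)
open import Data.Unit using (tt)
open import Data.Fin using (Fin; _≟_)
open import Data.Fin.Subset using (Subset; _∈_; _∉_; _⊆_; _∩_; ⊤; ⊥; ⁅_⁆; ∣_∣; inside; outside)
open import Data.Fin.Subset.Properties
  using (_∈?_; ⊆-refl; ⊆-trans; ⊆-antisym; ∈⊤; ∉⊥; x∈p∩q⁺; p⊆q⇒∣p∣≤∣q∣)
open import Data.Fin.Properties using (any?)
open import Data.Vec using (lookup; tabulate) renaming ([] to []ᵥ; _∷_ to _∷ᵥ_)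
open import Data.Vec.Properties using (lookup∘tabulate; lookup⇒[]=; []=⇒lookup)
open import Data.List using (List; []; _∷_; map; filter; length)
open import Data.List.Relation.Unary.Any using (here; there)
open import Data.List.Membership.Propositional using () renaming (_∈_ to _∈ₗ_)
open import Data.List.Membership.Propositional.Properties using (∈-map⁺; ∈-++⁺ˡ; ∈-++⁺ʳ)
open import Data.Product using (∃-syntax; _×_; _,_; proj₁; proj₂)
open import Data.Sum using (_⊎_; inj₁; inj₂)
open import Function.Base using (_∋_)
open import Level using (Level)
open import Relation.Binary.Core using (Rel)
open import Relation.Binary.Definitions using (Reflexive; Transitive)
open import Relation.Nullary using (¬_; Dec; yes; no; does; contradiction)
open import Relation.Nullary.Decidable
  using (dec-true; dec-false; decidable-stable; ¬?; _⊎-dec_; _×-dec_)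
open import Relation.Unary using (Pred; Decidable)
open import Relation.Binary.PropositionalEquality using (_≡_; _≢_; refl; sym; trans; subst)

private
  variable
    a ℓ p q : Level
    n k : ℕ

does≡true⇒ : {P : Set p} (P? : Dec P) → does P? ≡ true → P
does≡true⇒ (yes p) _ = p

module _ {A : Set a} {P : Pred A p} {Q : Pred A q} (P? : Decidable P) (Q? : Decidable Q) where

  length-filter-mono : (∀ x → P x → Q x) → ∀ xs →
                       length (filter P? xs) ≤ length (filter Q? xs)
  length-filter-mono P⇒Q []       = z≤n
  length-filter-mono P⇒Q (x ∷ xs) with P? x | Q? x
  ... | yes _  | yes _  = s≤s (length-filter-mono P⇒Q xs)
  ... | yes Px | no ¬Qx = contradiction (P⇒Q x Px) ¬Qx
  ... | no _   | yes _  = m≤n⇒m≤1+n (length-filter-mono P⇒Q xs)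
  ... | no _   | no _   = length-filter-mono P⇒Q xs

  sum-map-filter-mono : (f g : A → ℕ) → (∀ x → P x → Q x) → (∀ x → P x → f x ≤ g x) → ∀ xs →
                        sum (map f (filter P? xs)) ≤ sum (map g (filter Q? xs))
  sum-map-filter-mono f g P⇒Q f≤g []       = z≤n
  sum-map-filter-mono f g P⇒Q f≤g (x ∷ xs) with P? x | Q? x
  ... | yes Px | yes _  = +-mono-≤ (f≤g x Px) (sum-map-filter-mono f g P⇒Q f≤g xs)
  ... | yes Px | no ¬Qx = contradiction (P⇒Q x Px) ¬Qx
  ... | no _   | yes _  = ≤-trans (sum-map-filter-mono f g P⇒Q f≤g xs) (m≤n+m _ (g x))
  ... | no _   | no _   = sum-map-filter-mono f g P⇒Q f≤g xs

module _ {A : Set a} {_≤_ : Rel A ℓ} (≤-refl : Reflexive _≤_) (≤-trans : Transitive _≤_)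
         {P : Pred A p} (P? : Decidable P) where

  least-or-none-in : (∀ x y → P x → P y → x ≤ y ⊎ y ≤ x) → ∀ xs →
                     (∀ x → x ∈ₗ xs → ¬ P x) ⊎ ∃[ x ] (P x × ∀ y → y ∈ₗ xs → P y → x ≤ y)
  least-or-none-in total [] = inj₁ λ _ ()
  least-or-none-in total (z ∷ zs) with least-or-none-in total zs | P? z
  ... | inj₁ none | no ¬Pz = inj₁ λ { x (here refl) → ¬Pz ; x (there x∈) → none x x∈ }
  ... | inj₁ none | yes Pz =
    inj₂ (z , Pz , λ { y (here refl) _ → ≤-refl ; y (there y∈) Py → contradiction Py (none y y∈) })
  ... | inj₂ (x , Px , x≤) | no ¬Pz =
    inj₂ (x , Px , λ { y (here refl) Py → contradiction Py ¬Pz ; y (there y∈) Py → x≤ y y∈ Py })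
  ... | inj₂ (x , Px , x≤) | yes Pz with total z x Pz Px
  ...   | inj₁ z≤x =
    inj₂ (z , Pz , λ { y (here refl) _ → ≤-refl ; y (there y∈) Py → ≤-trans z≤x (x≤ y y∈ Py) })
  ...   | inj₂ x≤z =
    inj₂ (x , Px , λ { y (here refl) _ → x≤z ; y (there y∈) Py → x≤ y y∈ Py })

  least-or-none : (∀ x y → P x → P y → x ≤ y ⊎ y ≤ x) → (xs : List A) → (∀ x → x ∈ₗ xs) →
                  (∀ x → ¬ P x) ⊎ ∃[ x ] (P x × ∀ y → P y → x ≤ y)
  least-or-none total xs complete with least-or-none-in total xs
  ... | inj₁ none             = inj₁ λ x → none x (complete x)
  ... | inj₂ (x , Px , least) = inj₂ (x , Px , λ y → least y (complete y))

allSubsets-complete : ∀ n (A : Subset n) → A ∈ₗ allSubsets n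
allSubsets-complete zero    []ᵥ          = here refl
allSubsets-complete (suc n) (true ∷ᵥ A)  = ∈-++⁺ˡ (∈-map⁺ (inside ∷ᵥ_) (allSubsets-complete n A))
allSubsets-complete (suc n) (false ∷ᵥ A) =
  ∈-++⁺ʳ (map (inside ∷ᵥ_) (allSubsets n)) (∈-map⁺ (outside ∷ᵥ_) (allSubsets-complete n A))

least-subset-or-none : {P : Pred (Subset n) p} → Decidable P →
                       (∀ A B → P A → P B → A ⊆ B ⊎ B ⊆ A) →
                       (∀ A → ¬ P A) ⊎ ∃[ A ] (P A × ∀ B → P B → A ⊆ B)
least-subset-or-none {n} P? total =
  least-or-none {_≤_ = _⊆_} ⊆-refl ⊆-trans P? total (allSubsets n) (allSubsets-complete n)

module _ (T : LTree n k) (phylo : IsPhylo T) where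

  clusters-nested-or-disjoint : ∀ A B → IsCl T A → IsCl T B → A ⊆ B ⊎ B ⊆ A ⊎ A ∩ B ≡ ⊥
  clusters-nested-or-disjoint = proj₂ (proj₂ (proj₂ phylo))

  clusters-through-comparable : ∀ {x} A B → IsCl T A → IsCl T B → x ∈ A → x ∈ B → A ⊆ B ⊎ B ⊆ A
  clusters-through-comparable A B clA clB x∈A x∈B with clusters-nested-or-disjoint A B clA clB
  ... | inj₁ A⊆B        = inj₁ A⊆B
  ... | inj₂ (inj₁ B⊆A) = inj₂ B⊆A
  ... | inj₂ (inj₂ A∩B≡⊥) = contradiction (subst (_ ∈_) A∩B≡⊥ (x∈p∩q⁺ (x∈A , x∈B))) ∉⊥

isEdge : LTree n k → Subset n → Bool
isEdge T A = cl T A ∧ not (does (decSub A ⊤))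

module _ (T : LTree n k) (A : Subset n) where

  T-isEdge⁻ : Bool.T (isEdge T A) → IsEdge T A
  T-isEdge⁻ e with cl T A | decSub A ⊤
  ... | true | no A≢⊤ = refl , A≢⊤

  T-isEdge⁺ : IsEdge T A → Bool.T (isEdge T A)
  T-isEdge⁺ (clA , A≢⊤) rewrite clA | dec-false (decSub A ⊤) A≢⊤ = tt

module _ {T′ T : LTree n k} where

  coarseGraining-edge : CoarseGraining T′ T → ∀ A → IsEdge T′ A → IsEdge T A
  coarseGraining-edge (cl⊆ , _) A (clA , A≢⊤) = cl⊆ A clA , A≢⊤

  IsPhylo-coarsening : (∀ A → IsCl T′ A → IsCl T A) → IsCl T′ ⊤ → (∀ x → IsCl T′ ⁅ x ⁆) →
                       IsPhylo T → IsPhylo T′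
  IsPhylo-coarsening cl⊆ top singletons phylo =
    top , singletons , ¬-not ⊥∉T′ ,
    λ A B clA clB → clusters-nested-or-disjoint T phylo A B (cl⊆ A clA) (cl⊆ B clB)
    where
    ⊥∉T′ : ¬ IsCl T′ ⊥
    ⊥∉T′ cl⊥ with () ← trans (sym (proj₁ (proj₂ (proj₂ phylo)))) (cl⊆ ⊥ cl⊥)

  strict⇒¬reverse : StrictCoarseGraining T′ T → ¬ CoarseGraining T T′
  strict⇒¬reverse (_ , inj₁ (A , clA , ¬clA)) (cl⊇ , _) = ¬clA (cl⊇ A clA)
  strict⇒¬reverse (cg , inj₂ (A , edgeA , m , m∈ , m∉)) (_ , lab⊇) =
    m∉ (lab⊇ A (coarseGraining-edge cg A edgeA) m∈)

  ¬strict⇒reverse : CoarseGraining T′ T → ¬ StrictCoarseGraining T′ T → CoarseGraining T T′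
  ¬strict⇒reverse cg ¬strict = cl⊇ , lab⊇
    where
    cl⊇ : ∀ A → IsCl T A → IsCl T′ A
    cl⊇ A clA = decidable-stable (cl T′ A Bool.≟ true) λ ¬clA → ¬strict (cg , inj₁ (A , clA , ¬clA))
    lab⊇ : ∀ A → IsEdge T A → lab T A ⊆ lab T′ A
    lab⊇ A (clA , A≢⊤) {m} m∈ = decidable-stable (m ∈? lab T′ A)
      λ m∉ → ¬strict (cg , inj₂ (A , (cl⊇ A clA , A≢⊤) , m , m∈ , m∉))

  numVertices-mono : CoarseGraining T′ T → numVertices T′ ≤ numVertices T
  numVertices-mono (cl⊆ , _) =
    length-filter-mono (λ A → cl T′ A Bool.≟ true) (λ A → cl T A Bool.≟ true) cl⊆ (allSubsets n)

  labelWeight-mono : CoarseGraining T′ T → labelWeight T′ ≤ labelWeight T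
  labelWeight-mono cg@(_ , lab⊆) =
    sum-map-filter-mono (λ A → Bool.T? (isEdge T′ A)) (λ A → Bool.T? (isEdge T A))
      (λ A → ∣ lab T′ A ∣) (λ A → ∣ lab T A ∣)
      (λ A e → T-isEdge⁺ T A (coarseGraining-edge cg A (T-isEdge⁻ T′ A e)))
      (λ A e → p⊆q⇒∣p∣≤∣q∣ (lab⊆ A (T-isEdge⁻ T′ A e)))
      (allSubsets n)

EpsCluster : EpsMap n k → Subset n → Set
EpsCluster ε A = A ≡ ⊤ ⊎ (∃[ x ] A ≡ ⁅ x ⁆) ⊎ (∃[ y ] ∃[ m ] A ≡ Nbh ε m y)

module _ (ε : EpsMap n k) where

  ∈-Nbh? : ∀ m y x → Dec (x ≡ y ⊎ m ∉ ε x y)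
  ∈-Nbh? m y x = (x ≟ y) ⊎-dec ¬? (m ∈? ε x y)

  -- Nbh tabulates a local function defined by `with`; the ascription pins down the function in
  -- lookup∘tabulate, so that splitting on x ≟ y unfolds the entry.
  lookup-Nbh : ∀ m y x → lookup (Nbh ε m y) x ≡ does (∈-Nbh? m y x)
  lookup-Nbh m y x with (lookup (Nbh ε m y) x ≡ _ ∋ lookup∘tabulate _ x)
  ... | entry with x ≟ y
  ...   | yes _ = entry
  ...   | no _  = entry

  ∈-Nbh⁺ : ∀ {m y x} → (x ≢ y → m ∉ ε x y) → x ∈ Nbh ε m y
  ∈-Nbh⁺ {m} {y} {x} h =
    lookup⇒[]= _ _ (trans (lookup-Nbh m y x) (dec-true (∈-Nbh? m y x) x≡y⊎m∉))
    where
    x≡y⊎m∉ : x ≡ y ⊎ m ∉ ε x y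
    x≡y⊎m∉ with x ≟ y
    ... | yes x≡y = inj₁ x≡y
    ... | no x≢y  = inj₂ (h x≢y)

  ∈-Nbh⁻ : ∀ {m y x} → x ∈ Nbh ε m y → x ≡ y ⊎ m ∉ ε x y
  ∈-Nbh⁻ {m} {y} {x} x∈ = does≡true⇒ (∈-Nbh? m y x) (trans (sym (lookup-Nbh m y x)) ([]=⇒lookup x∈))

  epsCluster? : ∀ A → Dec (EpsCluster ε A)
  epsCluster? A = decSub A ⊤ ⊎-dec any? (λ x → decSub A ⁅ x ⁆)
                             ⊎-dec any? (λ y → any? (λ m → decSub A (Nbh ε m y)))

  IsCl-epsTree⁺ : ∀ A → EpsCluster ε A → IsCl (epsTree ε) A
  IsCl-epsTree⁺ A = dec-true (epsCluster? A)

  IsCl-epsTree⁻ : ∀ A → IsCl (epsTree ε) A → EpsCluster ε A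
  IsCl-epsTree⁻ A = does≡true⇒ (epsCluster? A)

  lab-epsTree⁺ : ∀ {A m y} → A ≡ Nbh ε m y → m ∈ lab (epsTree ε) A
  lab-epsTree⁺ {A} {m} {y} A≡N =
    lookup⇒[]= _ _ (trans (lookup∘tabulate _ m) (dec-true (any? λ y → decSub A (Nbh ε m y)) (y , A≡N)))

  lab-epsTree⁻ : ∀ A {m} → m ∈ lab (epsTree ε) A → ∃[ y ] A ≡ Nbh ε m y
  lab-epsTree⁻ A {m} m∈ =
    does≡true⇒ (any? λ y → decSub A (Nbh ε m y)) (trans (sym (lookup∘tabulate _ m)) ([]=⇒lookup m∈))

module _ (ε : EpsMap n k) (T : LTree n k) (phylo : IsPhylo T) (explains : Explains ε T) where

  MEdgeAbove : Fin k → Fin n → Subset n → Set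
  MEdgeAbove m y A = IsEdge T A × y ∈ A × m ∈ lab T A

  mEdgeAbove? : ∀ m y → Decidable (MEdgeAbove m y)
  mEdgeAbove? m y A =
    ((cl T A Bool.≟ true) ×-dec ¬? (decSub A ⊤)) ×-dec (y ∈? A) ×-dec (m ∈? lab T A)

  mEdgesAbove-comparable : ∀ {m y} A B → MEdgeAbove m y A → MEdgeAbove m y B → A ⊆ B ⊎ B ⊆ A
  mEdgesAbove-comparable A B ((clA , _) , y∈A , _) ((clB , _) , y∈B , _) =
    clusters-through-comparable T phylo A B clA clB y∈A y∈B

  ∈ε⇒separating-mEdge : ∀ {m x y} → x ≢ y → m ∈ ε x y → ∃[ A ] (MEdgeAbove m y A × x ∉ A)
  ∈ε⇒separating-mEdge {m} {x} {y} x≢y m∈ with proj₁ (explains x y x≢y m) m∈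
  ... | A , edgeA , y∈A , x∉A , m∈A = A , (edgeA , y∈A , m∈A) , x∉A

  separating-mEdge⇒∈ε : ∀ {m x y A} → MEdgeAbove m y A → x ∉ A → m ∈ ε x y
  separating-mEdge⇒∈ε {m} {x} {y} {A} (edgeA , y∈A , m∈A) x∉A =
    proj₂ (explains x y x≢y m) (A , edgeA , y∈A , x∉A , m∈A)
    where
    x≢y : x ≢ y
    x≢y refl = x∉A y∈A

  Nbh-edge : ∀ m y → Nbh ε m y ≡ ⊤ ⊎ MEdgeAbove m y (Nbh ε m y)
  Nbh-edge m y with least-subset-or-none (mEdgeAbove? m y) mEdgesAbove-comparable
  ... | inj₁ none = inj₁ (⊆-antisym (λ _ → ∈⊤) λ _ → ∈-Nbh⁺ ε λ x≢y m∈ →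
                      let A , above , _ = ∈ε⇒separating-mEdge x≢y m∈ in none A above)
  ... | inj₂ (A₀ , above₀@(_ , y∈A₀ , _) , least) =
    inj₂ (subst (MEdgeAbove m y) (sym (⊆-antisym N⊆A₀ A₀⊆N)) above₀)
    where
    N⊆A₀ : Nbh ε m y ⊆ A₀
    N⊆A₀ {x} x∈N with ∈-Nbh⁻ ε x∈N | x ∈? A₀
    ... | inj₁ refl | _        = y∈A₀
    ... | inj₂ _    | yes x∈A₀ = x∈A₀
    ... | inj₂ m∉   | no x∉A₀  = contradiction (separating-mEdge⇒∈ε above₀ x∉A₀) m∉
    A₀⊆N : A₀ ⊆ Nbh ε m y
    A₀⊆N x∈A₀ = ∈-Nbh⁺ ε λ x≢y m∈ →
      let B , aboveB , x∉B = ∈ε⇒separating-mEdge x≢y m∈ in x∉B (least B aboveB x∈A₀)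

  epsTree-coarseGraining : CoarseGraining (epsTree ε) T
  epsTree-coarseGraining = cl⊆ , lab⊆
    where
    cl⊆ : ∀ A → IsCl (epsTree ε) A → IsCl T A
    cl⊆ A clA with IsCl-epsTree⁻ ε A clA
    ... | inj₁ refl                  = proj₁ phylo
    ... | inj₂ (inj₁ (x , refl))     = proj₁ (proj₂ phylo) x
    ... | inj₂ (inj₂ (y , m , refl)) with Nbh-edge m y
    ...   | inj₁ N≡⊤               = subst (IsCl T) (sym N≡⊤) (proj₁ phylo)
    ...   | inj₂ ((clN , _) , _)   = clN
    lab⊆ : ∀ A → IsEdge (epsTree ε) A → lab (epsTree ε) A ⊆ lab T A
    lab⊆ A (_ , A≢⊤) {m} m∈ with lab-epsTree⁻ ε A m∈
    ... | y , refl with Nbh-edge m y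
    ...   | inj₁ N≡⊤              = contradiction N≡⊤ A≢⊤
    ...   | inj₂ (_ , _ , m∈N)    = m∈N

module _ (ε : EpsMap n k) (T : LTree n k) (cg : CoarseGraining (epsTree ε) T) where

  epsTree-isPhylo : IsPhylo T → IsPhylo (epsTree ε)
  epsTree-isPhylo =
    IsPhylo-coarsening {T′ = epsTree ε} {T = T} (proj₁ cg) (IsCl-epsTree⁺ ε ⊤ (inj₁ refl))
                       (λ x → IsCl-epsTree⁺ ε ⁅ x ⁆ (inj₂ (inj₁ (x , refl))))

  epsTree-explains : Explains ε T → Explains ε (epsTree ε)
  epsTree-explains explains x y x≢y m = separated , separated⇒∈ε
    where
    separated : m ∈ ε x y → ∃[ A ] (IsEdge (epsTree ε) A × y ∈ A × x ∉ A × m ∈ lab (epsTree ε) A)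
    separated m∈ = Nbh ε m y , (IsCl-epsTree⁺ ε _ (inj₂ (inj₂ (y , m , refl))) , N≢⊤) ,
                   ∈-Nbh⁺ ε (λ y≢y → contradiction refl y≢y) , x∉N , lab-epsTree⁺ ε refl
      where
      x∉N : x ∉ Nbh ε m y
      x∉N x∈N with ∈-Nbh⁻ ε x∈N
      ... | inj₁ x≡y = x≢y x≡y
      ... | inj₂ m∉ = m∉ m∈
      N≢⊤ : Nbh ε m y ≢ ⊤
      N≢⊤ N≡⊤ = x∉N (subst (x ∈_) (sym N≡⊤) ∈⊤)
    separated⇒∈ε : ∃[ A ] (IsEdge (epsTree ε) A × y ∈ A × x ∉ A × m ∈ lab (epsTree ε) A) → m ∈ ε x y
    separated⇒∈ε (A , edgeA , y∈A , x∉A , m∈A) =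
      proj₂ (explains x y x≢y m)
            (A , coarseGraining-edge cg A edgeA , y∈A , x∉A , proj₂ cg A edgeA m∈A)

module _ (ε : EpsMap n k) (E : LTree n k)
         (coarsest : ∀ T → IsPhylo T → Explains ε T → CoarseGraining E T) where

  coarsest⇒leastResolved : Explains ε E → LeastResolved ε E
  coarsest⇒leastResolved explainsE =
    explainsE , λ T′ phylo′ strict explains′ → strict⇒¬reverse strict (coarsest T′ phylo′ explains′)

  leastResolved⇒isomorphic-to-coarsest : IsPhylo E → Explains ε E →
                                         ∀ T → IsPhylo T → LeastResolved ε T → Isomorphic T E
  leastResolved⇒isomorphic-to-coarsest phyloE explainsE T phylo (explainsT , noStrict) =
    ¬strict⇒reverse cg (λ strict → noStrict E phyloE strict explainsE) , cg
    where
    cg : CoarseGraining E T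
    cg = coarsest T phylo explainsT

theorem3 : (n k : ℕ) → 1 ≤ n → 1 ≤ k → (ε : EpsMap n k) → IsFitch ε →
    (IsPhylo (epsTree ε) × LeastResolved ε (epsTree ε)) ×
    (∀ T → IsPhylo T → LeastResolved ε T → Isomorphic T (epsTree ε)) ×
    (∀ T → IsPhylo T → Explains ε T →
      (numVertices (epsTree ε) ≤ numVertices T) × (labelWeight (epsTree ε) ≤ labelWeight T))
theorem3 n k _ _ ε (T₀ , phylo₀ , explains₀) =
    (phylo , coarsest⇒leastResolved ε (epsTree ε) coarsest explains)
  , leastResolved⇒isomorphic-to-coarsest ε (epsTree ε) coarsest phylo explains
  , λ T phyloT explainsT → let cg = coarsest T phyloT explainsT in
                           numVertices-mono cg , labelWeight-mono cg
  where
  coarsest : ∀ T → IsPhylo T → Explains ε T → CoarseGraining (epsTree ε) T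
  coarsest = epsTree-coarseGraining ε
  phylo : IsPhylo (epsTree ε)
  phylo = epsTree-isPhylo ε T₀ (coarsest T₀ phylo₀ explains₀) phylo₀
  explains : Explains ε (epsTree ε)
  explains = epsTree-explains ε T₀ (coarsest T₀ phylo₀ explains₀) explains₀
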